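{- It is not the case that CYCLIC FLATS $\leq$ DEPENDENT HYPERPLANES; that is, there is no Turing machine running in time polynomial in its input length which, for every matroid $M$, given the list of all cyclic flats of $M$ with their ranks outputs the rank of $M$ together with the list of all dependent hyperplanes of $M$.
   Context: All matroids are finite. A cyclic flat is a flat that is a (possibly empty) union of circuits. A matroid is described to a Turing machine by a list of subsets of its ground set $E$ ($|E| = n$), each subset encoded by its characteristic vector (ranks in binary), with a reasonable encoding (no padding), so a description listing $i$ subsets has length $\Theta(ni)$. The DEPENDENT HYPERPLANES description consists of $r(M)$ and the list of all dependent hyperplanes (only $r(M)$ if there are none). For two description types $I_1, I_2$, $I_1 \leq I_2$ means there is a polynomial-time Turing machine producing the $I_2$-description of $M$ from the $I_1$-description of $M$, for every matroid $M$. -}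

module Defs where

open import Data.Nat using (ℕ; zero; suc; _+_; _*_; _∸_; _^_; _≤_; _<_; _≡ᵇ_; _%_; _/_)
open import Data.Bool using (Bool; true; false; if_then_else_)
open import Data.Fin using (Fin)
open import Data.Fin.Subset using (Subset; _∪_; _∩_; ⊤; ⁅_⁆; _∈_; _∉_; _⊆_; _⊂_; ∣_∣)
open import Data.Vec using (toList)
open import Data.List using (List; []; _∷_; _++_; concatMap; reverse; map; length)
import Data.List.Membership.Propositional as LM
open import Data.List.Relation.Unary.Unique.Propositional using (Unique)
open import Data.Maybe using (Maybe; just; nothing)
open import Data.Product using (Σ; Σ-syntax; ∃; ∃-syntax; _×_; _,_)
open import Function.Bundles using (_⇔_)
open import Relation.Binary.PropositionalEquality using (_≡_)

record Matroid (n : ℕ) : Set where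
  field
    r        : Subset n → ℕ
    r-bound  : ∀ X → r X ≤ ∣ X ∣
    r-mono   : ∀ X Y → X ⊆ Y → r X ≤ r Y
    r-submod : ∀ X Y → r (X ∪ Y) + r (X ∩ Y) ≤ r X + r Y

module _ {n : ℕ} (M : Matroid n) where
  open Matroid M

  rankM : ℕ
  rankM = r ⊤

  Dependent : Subset n → Set
  Dependent X = r X < ∣ X ∣

  Independent : Subset n → Set
  Independent X = r X ≡ ∣ X ∣

  IsCircuit : Subset n → Set
  IsCircuit C = Dependent C × (∀ D → D ⊂ C → Independent D)

  IsFlat : Subset n → Set
  IsFlat X = ∀ e → e ∉ X → r X < r (⁅ e ⁆ ∪ X)

  UnionOfCircuits : Subset n → Set
  UnionOfCircuits X = ∀ e → e ∈ X → ∃[ C ] (IsCircuit C × e ∈ C × C ⊆ X)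

  IsCyclicFlat : Subset n → Set
  IsCyclicFlat X = IsFlat X × UnionOfCircuits X

  IsHyperplane : Subset n → Set
  IsHyperplane X = IsFlat X × suc (r X) ≡ rankM

  IsDependentHyperplane : Subset n → Set
  IsDependentHyperplane X = IsHyperplane X × Dependent X

Enumerates : {n : ℕ} → (Subset n → Set) → List (Subset n) → Set
Enumerates P L = Unique L × (∀ X → (X LM.∈ L) ⇔ P X)

data Sym : Set where
  b0 b1 sep end : Sym

bit : Bool → Sym
bit true  = b1
bit false = b0

binLSB : ℕ → ℕ → List Bool
binLSB zero       m = []
binLSB (suc fuel) zero = []
binLSB (suc fuel) m@(suc _) = (m % 2 ≡ᵇ 1) ∷ binLSB fuel (m / 2)

binary : ℕ → List Sym
binary zero      = b0 ∷ []
binary m@(suc _) = map bit (reverse (binLSB m m))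

charVec : {n : ℕ} → Subset n → List Sym
charVec X = map bit (toList X)

cyclicFlatsDesc : {n : ℕ} → Matroid n → List (Subset n) → List Sym
cyclicFlatsDesc M L =
  concatMap (λ X → charVec X ++ (sep ∷ binary (Matroid.r M X) ++ (end ∷ []))) L

depHyperplanesDesc : {n : ℕ} → Matroid n → List (Subset n) → List Sym
depHyperplanesDesc M L =
  binary (rankM M) ++ concatMap (λ H → end ∷ charVec H) L

-- Deterministic single-tape Turing machines (one-way infinite tape).

data TapeSym (k : ℕ) : Set where
  blank : TapeSym k
  sym   : Sym → TapeSym k
  aux   : Fin k → TapeSym k

data Move : Set where
  left right stay : Move

-- states Fin (suc Q), start state zero; δ = nothing means halt
record TM : Set where
  field
    Q : ℕ
    k : ℕ
    δ : Fin (suc Q) → TapeSym k → Maybe (Fin (suc Q) × TapeSym k × Move)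

module _ (T : TM) where
  open TM T

  record Config : Set where
    constructor conf
    field
      state : Fin (suc Q)
      head  : ℕ
      tape  : ℕ → TapeSym k

  tapeOf : List Sym → ℕ → TapeSym k
  tapeOf []       _       = blank
  tapeOf (x ∷ xs) zero    = sym x
  tapeOf (x ∷ xs) (suc i) = tapeOf xs i

  initial : List Sym → Config
  initial w = conf Fin.zero 0 (tapeOf w)

  move : Move → ℕ → ℕ
  move left  h = h ∸ 1
  move right h = suc h
  move stay  h = h

  step : Config → Maybe Config
  step (conf q h t) with δ q (t h)
  ... | nothing = nothing
  ... | just (q' , s , m) =
        just (conf q' (move m h) (λ i → if i ≡ᵇ h then s else t i))

  run : ℕ → Config → Config
  run zero    c = c
  run (suc t) c with step c
  ... | nothing = c
  ... | just c' = run t c'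

  Halted : Config → Set
  Halted c = step c ≡ nothing

  -- the tape starts with the word w, followed by a blank cell
  OutputIs : Config → List Sym → Set
  OutputIs c w = ∀ i → i ≤ length w → Config.tape c i ≡ tapeOf w i

  HaltsWithin : List Sym → ℕ → List Sym → Set
  HaltsWithin w t v = Halted (run t (initial w)) × OutputIs (run t (initial w)) v

CFtoDHInPolyTime : TM → ℕ → ℕ → Set
CFtoDHInPolyTime T c d =
  ∀ (n : ℕ) (M : Matroid n) (L : List (Subset n)) →
  Enumerates (IsCyclicFlat M) L →
  Σ[ t ∈ ℕ ] (t ≤ c * length (cyclicFlatsDesc M L) ^ d + c ×
    Σ[ L' ∈ List (Subset n) ] (Enumerates (IsDependentHyperplane M) L' ×
      HaltsWithin T (cyclicFlatsDesc M L) t (depHyperplanesDesc M L')))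

CyclicFlats≤DependentHyperplanes : Set
CyclicFlats≤DependentHyperplanes =
  Σ[ T ∈ TM ] Σ[ c ∈ ℕ ] Σ[ d ∈ ℕ ] CFtoDHInPolyTime T c d

-- Let M be the uniform matroid U(K + 1, 2K + 2) with an added loop 0. Its only cyclic
-- flats are {0} and E, so its CYCLIC FLATS description has length O(K). But {0} ∪ Y
-- is a dependent hyperplane for every K-subset Y of E ∖ {0}, and picking one element
-- from each of K disjoint pairs already yields 2^K of them, so the DEPENDENT
-- HYPERPLANES description has length at least 2^K. A Turing machine writes at most
-- one cell per step, so it needs at least 2^K − O(K) steps: no polynomial suffices.

module Submission where

open import Defs hiding (sym)

open import Data.Bool using (true; false; if_then_else_)
open import Data.Fin using (Fin; zero; suc; combine; funToFin; finToFun)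
open import Data.Fin.Properties using (injective⇒≤; funToFin-finToFin)
open import Data.Fin.Subset using (Subset; ⊥; ⊤; ⁅_⁆; _∪_; _∩_; _∈_; _⊂_; ∣_∣)
open import Data.Fin.Subset.Properties
open import Data.List using (List; []; _∷_; _++_; length; map; reverse; concatMap)
open import Data.List.Properties using (length-map; length-reverse; length-++; length-++-≤ʳ)
open import Data.List.Membership.Propositional using () renaming (_∈_ to _∈ˡ_)
open import Data.List.Membership.Setoid.Properties using (index-injective)
open import Data.List.Relation.Unary.All using ([]; _∷_)
open import Data.List.Relation.Unary.AllPairs using ([]; _∷_)
open import Data.List.Relation.Unary.Any using (index; here; there)
open import Data.List.Relation.Unary.Unique.Propositional using (Unique)
open import Data.Maybe using (just; nothing)
open import Data.Nat
open import Data.Nat.Properties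
open import Data.Nat.Solver using (module +-*-Solver)
open import Data.Product using (∃-syntax; Σ-syntax; _×_; _,_; proj₁; proj₂)
open import Data.Sum using (_⊎_; inj₁; inj₂)
open import Data.Vec using ([]; _∷_; tail; here; there; toList) renaming (_++_ to _++ᵛ_)
open import Data.Vec.Properties using (length-toList; ++-injectiveˡ; ++-injectiveʳ)
open import Function using (_∘_)
open import Function.Bundles using (mk⇔; Equivalence)
open import Function.Definitions using (Injective)
open import Relation.Binary.PropositionalEquality
open import Relation.Nullary using (¬_; yes; no; contradiction)

⊓-concave : ∀ k {u v x y} → u + v ≤ x + y → v ≤ x → v ≤ y → u ⊓ k + v ⊓ k ≤ x ⊓ k + y ⊓ k
⊓-concave k {u} {v} {x} {y} u+v≤x+y v≤x v≤y with k ≤? x | k ≤? y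
... | yes k≤x | _ = begin
  u ⊓ k + v ⊓ k  ≤⟨ +-mono-≤ (m⊓n≤n u k) (⊓-monoˡ-≤ k v≤y) ⟩
  k + y ⊓ k      ≡⟨ cong (_+ y ⊓ k) (m≥n⇒m⊓n≡n k≤x) ⟨
  x ⊓ k + y ⊓ k  ∎
  where open ≤-Reasoning
... | no _ | yes k≤y = begin
  u ⊓ k + v ⊓ k  ≡⟨ +-comm (u ⊓ k) (v ⊓ k) ⟩
  v ⊓ k + u ⊓ k  ≤⟨ +-mono-≤ (⊓-monoˡ-≤ k v≤x) (m⊓n≤n u k) ⟩
  x ⊓ k + k      ≡⟨ cong (x ⊓ k +_) (m≥n⇒m⊓n≡n k≤y) ⟨
  x ⊓ k + y ⊓ k  ∎
  where open ≤-Reasoning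
... | no k≰x | no k≰y = begin
  u ⊓ k + v ⊓ k  ≤⟨ +-mono-≤ (m⊓n≤m u k) (m⊓n≤m v k) ⟩
  u + v          ≤⟨ u+v≤x+y ⟩
  x + y          ≡⟨ cong₂ _+_ (m≤n⇒m⊓n≡m (<⇒≤ (≰⇒> k≰x))) (m≤n⇒m⊓n≡m (<⇒≤ (≰⇒> k≰y))) ⟨
  x ⊓ k + y ⊓ k  ∎
  where open ≤-Reasoning

>⇒≡ᵇ-false : ∀ {h i} → h < i → (i ≡ᵇ h) ≡ false
>⇒≡ᵇ-false {zero}  {suc i} _         = refl
>⇒≡ᵇ-false {suc h} {suc i} (s<s h<i) = >⇒≡ᵇ-false h<i

1+n≤2*n : ∀ {n} → 0 < n → suc n ≤ 2 * n
1+n≤2*n {n} 0<n = +-mono-≤ 0<n (≤-reflexive (sym (+-identityʳ n)))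

n<2^n : ∀ n → n < 2 ^ n
n<2^n zero    = z<s
n<2^n (suc n) = ≤-trans (s<s (n<2^n n)) (1+n≤2*n (m^n>0 2 n))

^-distribʳ-* : ∀ m n o → (m * n) ^ o ≡ m ^ o * n ^ o
^-distribʳ-* m n zero    = refl
^-distribʳ-* m n (suc o) = begin
  m * n * (m * n) ^ o      ≡⟨ cong (m * n *_) (^-distribʳ-* m n o) ⟩
  m * n * (m ^ o * n ^ o)  ≡⟨ [m*n]*[o*p]≡[m*o]*[n*p] m n (m ^ o) (n ^ o) ⟩
  m * m ^ o * (n * n ^ o)  ∎
  where open ≡-Reasoning

-- With z = 2a and y = 2z: a (y + 1) < (z + 1)² ≤ 2^z · 2^z = 2^y.
linear<exponential : ∀ a → ∃[ y ] a * suc y < 2 ^ y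
linear<exponential a = z + z , (begin-strict
  a * suc (z + z)                <⟨ s≤s (m≤m+n _ (3 * a)) ⟩
  suc (a * suc (z + z) + 3 * a)  ≡⟨ square a ⟨
  suc z * suc z                  ≤⟨ *-mono-≤ (n<2^n z) (n<2^n z) ⟩
  2 ^ z * 2 ^ z                  ≡⟨ ^-distribˡ-+-* 2 z z ⟨
  2 ^ (z + z)                    ∎)
  where
  open ≤-Reasoning
  z = a + a
  square : ∀ a → suc (a + a) * suc (a + a) ≡ suc (a * suc (a + a + (a + a)) + 3 * a)
  square = solve 1 (λ a → (con 1 :+ (a :+ a)) :* (con 1 :+ (a :+ a))
                       := con 1 :+ (a :* (con 1 :+ ((a :+ a) :+ (a :+ a))) :+ con 3 :* a)) refl
    where open +-*-Solver

-- With K = 2^y: a (K + 1)^e ≤ 2^(a + (y + 1) e), and the exponent is below 2^y = K.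
polynomial<exponential : ∀ a e → ∃[ K ] a * suc K ^ e < 2 ^ K
polynomial<exponential a e with y , a+e<2^y ← linear<exponential (a + e) = 2 ^ y , (begin-strict
  a * suc (2 ^ y) ^ e      ≤⟨ *-mono-≤ (<⇒≤ (n<2^n a)) (^-monoˡ-≤ e (1+n≤2*n (m^n>0 2 y))) ⟩
  2 ^ a * (2 ^ suc y) ^ e  ≡⟨ cong (2 ^ a *_) (^-*-assoc 2 (suc y) e) ⟩
  2 ^ a * 2 ^ (suc y * e)  ≡⟨ ^-distribˡ-+-* 2 a (suc y * e) ⟨
  2 ^ (a + suc y * e)      <⟨ ^-monoʳ-< 2 (s≤s (s≤s z≤n)) exponent< ⟩
  2 ^ 2 ^ y                ∎)
  where
  open ≤-Reasoning
  exponent< : a + suc y * e < 2 ^ y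
  exponent< = begin-strict
    a + suc y * e          ≤⟨ +-mono-≤ (m≤m*n a (suc y)) (≤-reflexive (*-comm (suc y) e)) ⟩
    a * suc y + e * suc y  ≡⟨ *-distribʳ-+ (suc y) a e ⟨
    (a + e) * suc y        <⟨ a+e<2^y ⟩
    2 ^ y                  ∎

polynomial∘linear<exponential : ∀ c d b → ∃[ K ] c * (b * suc K) ^ d + c + b * suc K < 2 ^ K
polynomial∘linear<exponential c d b with K , lt ← polynomial<exponential (c * b ^ d + c + b) (suc d) =
  K , (begin-strict
  c * (b * x) ^ d + c + b * x          ≡⟨ cong (λ z → c * z + c + b * x) (^-distribʳ-* b x d) ⟩
  c * (b ^ d * x ^ d) + c + b * x      ≤⟨ +-mono-≤ (+-mono-≤ (*-monoʳ-≤ c (*-monoʳ-≤ (b ^ d) (m≤n*m (x ^ d) x)))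
                                                             (m≤m*n c (x ^ suc d) {{m^n≢0 x (suc d)}}))
                                                   (*-monoʳ-≤ b (m≤m*n x (x ^ d) {{m^n≢0 x d}})) ⟩
  c * (b ^ d * x ^ suc d) + c * x ^ suc d + b * x ^ suc d
                                       ≡⟨ collect c (b ^ d) b (x ^ suc d) ⟩
  (c * b ^ d + c + b) * x ^ suc d      <⟨ lt ⟩
  2 ^ K                                ∎)
  where
  open ≤-Reasoning
  x = suc K
  collect : ∀ c p b X → c * (p * X) + c * X + b * X ≡ (c * p + c + b) * X
  collect = solve 4 (λ c p b X → c :* (p :* X) :+ c :* X :+ b :* X := (c :* p :+ c :+ b) :* X) refl
    where open +-*-Solver

injection⇒≤length : ∀ {a} {A : Set a} {n} {xs : List A} (g : Fin n → A) →
                    Injective _≡_ _≡_ g → (∀ i → g i ∈ˡ xs) → n ≤ length xs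
injection⇒≤length {A = A} g g-injective g∈xs =
  injective⇒≤ λ {i} {j} eq → g-injective (index-injective (setoid A) (g∈xs i) (g∈xs j) eq)

funToFin-cong : ∀ {m n} {f g : Fin m → Fin n} → (∀ i → f i ≡ g i) → funToFin f ≡ funToFin g
funToFin-cong {zero}  f≗g = refl
funToFin-cong {suc m} f≗g = cong₂ combine (f≗g zero) (funToFin-cong (f≗g ∘ suc))

finToFun-injective : ∀ {m n} {i j : Fin (m ^ n)} → (∀ x → finToFun {m} {n} i x ≡ finToFun j x) → i ≡ j
finToFun-injective {m} {n} {i} {j} eq = begin
  i                               ≡⟨ funToFin-finToFin {n} {m} i ⟨
  funToFin (finToFun {m} {n} i)  ≡⟨ funToFin-cong eq ⟩
  funToFin (finToFun {m} {n} j)  ≡⟨ funToFin-finToFin {n} {m} j ⟩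
  j                               ∎
  where open ≡-Reasoning

∣p++q∣≡∣p∣+∣q∣ : ∀ {m n} (p : Subset m) (q : Subset n) → ∣ p ++ᵛ q ∣ ≡ ∣ p ∣ + ∣ q ∣
∣p++q∣≡∣p∣+∣q∣ []          q = refl
∣p++q∣≡∣p∣+∣q∣ (true ∷ p)  q = cong suc (∣p++q∣≡∣p∣+∣q∣ p q)
∣p++q∣≡∣p∣+∣q∣ (false ∷ p) q = ∣p++q∣≡∣p∣+∣q∣ p q

∣p∪q∣+∣p∩q∣≡∣p∣+∣q∣ : ∀ {n} (p q : Subset n) → ∣ p ∪ q ∣ + ∣ p ∩ q ∣ ≡ ∣ p ∣ + ∣ q ∣
∣p∪q∣+∣p∩q∣≡∣p∣+∣q∣ []          []          = refl
∣p∪q∣+∣p∩q∣≡∣p∣+∣q∣ (true ∷ p)  (true ∷ q)  = cong suc (begin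
  ∣ p ∪ q ∣ + suc ∣ p ∩ q ∣  ≡⟨ +-suc ∣ p ∪ q ∣ ∣ p ∩ q ∣ ⟩
  suc (∣ p ∪ q ∣ + ∣ p ∩ q ∣) ≡⟨ cong suc (∣p∪q∣+∣p∩q∣≡∣p∣+∣q∣ p q) ⟩
  suc (∣ p ∣ + ∣ q ∣)         ≡⟨ +-suc ∣ p ∣ ∣ q ∣ ⟨
  ∣ p ∣ + suc ∣ q ∣           ∎)
  where open ≡-Reasoning
∣p∪q∣+∣p∩q∣≡∣p∣+∣q∣ (true ∷ p)  (false ∷ q) = cong suc (∣p∪q∣+∣p∩q∣≡∣p∣+∣q∣ p q)
∣p∪q∣+∣p∩q∣≡∣p∣+∣q∣ (false ∷ p) (true ∷ q)  =
  trans (cong suc (∣p∪q∣+∣p∩q∣≡∣p∣+∣q∣ p q)) (sym (+-suc ∣ p ∣ ∣ q ∣))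
∣p∪q∣+∣p∩q∣≡∣p∣+∣q∣ (false ∷ p) (false ∷ q) = ∣p∪q∣+∣p∩q∣≡∣p∣+∣q∣ p q

⁅⁆-injective : ∀ {n} {x y : Fin n} → ⁅ x ⁆ ≡ ⁅ y ⁆ → x ≡ y
⁅⁆-injective {x = x} {y} eq = x∈⁅y⁆⇒x≡y y (subst (x ∈_) eq (x∈⁅x⁆ x))

subset-of-size : ∀ {m} j → j ≤ m → Σ[ Z ∈ Subset m ] ∣ Z ∣ ≡ j
subset-of-size {m}     zero    _         = ⊥ , ∣⊥∣≡0 m
subset-of-size {suc m} (suc j) (s≤s j≤m) with Z , ∣Z∣≡j ← subset-of-size j j≤m =
  true ∷ Z , cong suc ∣Z∣≡j

subset-of-size-∋ : ∀ {m} (i : Fin m) j → j < m → Σ[ Z ∈ Subset m ] ∣ Z ∣ ≡ suc j × i ∈ Z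
subset-of-size-∋ zero j (s≤s j≤m) with Z , ∣Z∣≡j ← subset-of-size j j≤m =
  true ∷ Z , cong suc ∣Z∣≡j , here
subset-of-size-∋ {suc m} (suc i) j (s≤s j≤m) with j <? m
... | yes j<m with Z , ∣Z∣≡1+j , i∈Z ← subset-of-size-∋ i j j<m = false ∷ Z , ∣Z∣≡1+j , there i∈Z
... | no  j≮m = ⊤ , cong suc (trans (∣⊤∣≡n m) (sym (≤∧≮⇒≡ j≤m j≮m))) , ∈⊤

blocks : ∀ {K b} → (Fin K → Fin b) → Subset (K * b)
blocks {zero}  f = []
blocks {suc K} f = ⁅ f zero ⁆ ++ᵛ blocks (f ∘ suc)

∣blocks∣ : ∀ {K b} (f : Fin K → Fin b) → ∣ blocks f ∣ ≡ K
∣blocks∣ {zero}  f = refl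
∣blocks∣ {suc K} f = begin
  ∣ ⁅ f zero ⁆ ++ᵛ blocks (f ∘ suc) ∣    ≡⟨ ∣p++q∣≡∣p∣+∣q∣ ⁅ f zero ⁆ (blocks (f ∘ suc)) ⟩
  ∣ ⁅ f zero ⁆ ∣ + ∣ blocks (f ∘ suc) ∣  ≡⟨ cong₂ _+_ (∣⁅x⁆∣≡1 (f zero)) (∣blocks∣ (f ∘ suc)) ⟩
  suc K                                  ∎
  where open ≡-Reasoning

blocks-injective : ∀ {K b} (f g : Fin K → Fin b) → blocks f ≡ blocks g → ∀ i → f i ≡ g i
blocks-injective {suc K} f g eq zero    = ⁅⁆-injective (++-injectiveˡ ⁅ f zero ⁆ ⁅ g zero ⁆ eq)
blocks-injective {suc K} f g eq (suc i) =
  blocks-injective (f ∘ suc) (g ∘ suc) (++-injectiveʳ ⁅ f zero ⁆ ⁅ g zero ⁆ eq) i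

-- Element zero is a loop; the elements 1, …, m form the uniform matroid U(k, m).
uniformWithLoop : (k m : ℕ) → Matroid (suc m)
uniformWithLoop k m = record
  { r        = λ X → ∣ tail X ∣ ⊓ k
  ; r-bound  = λ { (b ∷ Y) → ≤-trans (m⊓n≤m ∣ Y ∣ k) (∣p∣≤∣x∷p∣ b Y) }
  ; r-mono   = λ { (_ ∷ _) (_ ∷ _) X⊆Y → ⊓-monoˡ-≤ k (p⊆q⇒∣p∣≤∣q∣ (drop-∷-⊆ X⊆Y)) }
  ; r-submod = λ { (_ ∷ Y) (_ ∷ Z) → ⊓-concave k (≤-reflexive (∣p∪q∣+∣p∩q∣≡∣p∣+∣q∣ Y Z))
                                                 (∣p∩q∣≤∣p∣ Y Z) (∣p∩q∣≤∣q∣ Y Z) }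
  }

module UniformWithLoop (k m : ℕ) where

  M : Matroid (suc m)
  M = uniformWithLoop k m

  open Matroid M using (r; r-bound)

  ⁅0⁆-isCircuit : IsCircuit M ⁅ zero ⁆
  ⁅0⁆-isCircuit = s≤s (m⊓n≤m ∣ ⊥ {m} ∣ k) , independent
    where
    independent : ∀ D → D ⊂ ⁅ zero ⁆ → Independent M D
    independent D D⊂⁅0⁆ = trans (n≤0⇒n≡0 (≤-trans (r-bound D) (≤-reflexive ∣D∣≡0))) (sym ∣D∣≡0)
      where
      ∣D∣≡0 : ∣ D ∣ ≡ 0
      ∣D∣≡0 = n≤0⇒n≡0 (≤-trans (≤-pred (p⊂q⇒∣p∣<∣q∣ D⊂⁅0⁆)) (≤-reflexive (∣⊥∣≡0 m)))

  loopless-isCircuit : ∀ {Z} → ∣ Z ∣ ≡ suc k → IsCircuit M (false ∷ Z)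
  loopless-isCircuit {Z} ∣Z∣≡1+k = dependent , independent
    where
    dependent : Dependent M (false ∷ Z)
    dependent rewrite ∣Z∣≡1+k = s≤s (m⊓n≤n (suc k) k)
    independent : ∀ D → D ⊂ false ∷ Z → Independent M D
    independent (true ∷ _) (D⊆Z , _) with () ← D⊆Z here
    independent (false ∷ D) D⊂Z =
      m≤n⇒m⊓n≡m (≤-pred (subst (∣ D ∣ <_) ∣Z∣≡1+k (p⊂q⇒∣p∣<∣q∣ D⊂Z)))

  loopless-dependent : ∀ {Z} → Dependent M (false ∷ Z) → k < ∣ Z ∣
  loopless-dependent {Z} dependent =
    ≰⇒> λ ∣Z∣≤k → <-irrefl (m≤n⇒m⊓n≡m ∣Z∣≤k) dependent

  circuit∋nonloop⇒large : ∀ {C i} → IsCircuit M C → suc i ∈ C → k < ∣ tail C ∣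
  circuit∋nonloop⇒large {false ∷ Z} (dependent , _) _ = loopless-dependent {Z} dependent
  circuit∋nonloop⇒large {true ∷ Z} {i} (_ , minimal) (there i∈Z) =
    contradiction (minimal ⁅ zero ⁆ ⁅0⁆⊂C) λ eq → <-irrefl eq (proj₁ ⁅0⁆-isCircuit)
    where
    ⁅0⁆⊂C : ⁅ zero ⁆ ⊂ true ∷ Z
    ⁅0⁆⊂C = (λ { here → here ; (there x∈⊥) → contradiction x∈⊥ ∉⊥ })
          , suc i , there i∈Z , λ { (there i∈⊥) → ∉⊥ i∈⊥ }

  flat∋0 : ∀ {X} → IsFlat M X → zero ∈ X
  flat∋0 {true ∷ Y}  _    = here
  flat∋0 {false ∷ Y} flat =
    contradiction (flat zero λ ()) (<-irrefl (cong (λ Z → ∣ Z ∣ ⊓ k) (sym (∪-identityˡ Y))))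

  flat-large⇒⊤ : ∀ {Y} → IsFlat M (true ∷ Y) → k ≤ ∣ Y ∣ → Y ≡ ⊤
  flat-large⇒⊤ {Y} flat k≤∣Y∣ = ⊆-antisym ⊆⊤ λ {j} _ → ∈Y j
    where
    ∈Y : ∀ j → j ∈ Y
    ∈Y j with j ∈? Y
    ... | yes j∈Y = j∈Y
    ... | no  j∉Y = contradiction (≤-trans (m⊓n≤n _ k) (≤-reflexive (sym (m≥n⇒m⊓n≡n k≤∣Y∣))))
                                  (<⇒≱ (flat (suc j) (j∉Y ∘ drop-there)))

  cyclicFlat⇒⁅0⁆⊎⊤ : ∀ {X} → IsCyclicFlat M X → X ≡ ⁅ zero ⁆ ⊎ X ≡ ⊤
  cyclicFlat⇒⁅0⁆⊎⊤ {false ∷ Y} (flat , _) with () ← flat∋0 flat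
  cyclicFlat⇒⁅0⁆⊎⊤ {true ∷ Y}  (flat , cyclic) with nonempty? Y
  ... | no  Y-empty = inj₁ (cong (true ∷_) (Empty-unique Y-empty))
  ... | yes (i , i∈Y) with (_ ∷ Z) , circuit , i∈C , C⊆X ← cyclic (suc i) (there i∈Y) =
    inj₂ (cong (true ∷_) (flat-large⇒⊤ flat (<⇒≤ (≤-trans k<∣Z∣ (p⊆q⇒∣p∣≤∣q∣ (drop-∷-⊆ C⊆X))))))
    where
    k<∣Z∣ : k < ∣ Z ∣
    k<∣Z∣ = circuit∋nonloop⇒large circuit i∈C

  ⁅0⁆-isCyclicFlat : 0 < k → IsCyclicFlat M ⁅ zero ⁆
  ⁅0⁆-isCyclicFlat 0<k = flat , cyclic
    where
    flat : IsFlat M ⁅ zero ⁆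
    flat zero    0∉⁅0⁆ = contradiction here 0∉⁅0⁆
    flat (suc j) _ rewrite ∣⊥∣≡0 m | ∪-identityʳ ⁅ j ⁆ | ∣⁅x⁆∣≡1 j = ⊓-glb ≤-refl 0<k
    cyclic : UnionOfCircuits M ⁅ zero ⁆
    cyclic zero    _           = ⁅ zero ⁆ , ⁅0⁆-isCircuit , here , ⊆-refl
    cyclic (suc j) (there j∈⊥) = contradiction j∈⊥ ∉⊥

  ⊤-isCyclicFlat : k < m → IsCyclicFlat M ⊤
  ⊤-isCyclicFlat k<m = (λ _ e∉⊤ → contradiction ∈⊤ e∉⊤) , cyclic
    where
    cyclic : UnionOfCircuits M ⊤
    cyclic zero    _ = ⁅ zero ⁆ , ⁅0⁆-isCircuit , here , ⊆⊤
    cyclic (suc i) _ with Z , ∣Z∣≡1+k , i∈Z ← subset-of-size-∋ i k k<m =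
      false ∷ Z , loopless-isCircuit ∣Z∣≡1+k , there i∈Z , ⊆⊤

  cyclicFlats : 0 < k → k < m → Enumerates (IsCyclicFlat M) (⁅ zero ⁆ ∷ ⊤ ∷ [])
  cyclicFlats 0<k k<m = unique , λ X → mk⇔ (to X) from
    where
    ⁅0⁆≢⊤ : ⁅ zero ⁆ ≢ ⊤
    ⁅0⁆≢⊤ eq = <⇒≢ (s<s (<-trans 0<k k<m))
      (trans (sym (∣⁅x⁆∣≡1 {suc m} zero)) (trans (cong ∣_∣ eq) (∣⊤∣≡n (suc m))))
    unique : Unique (⁅ zero ⁆ ∷ ⊤ ∷ [])
    unique = (⁅0⁆≢⊤ ∷ []) ∷ [] ∷ []
    to : ∀ X → X ∈ˡ ⁅ zero ⁆ ∷ ⊤ ∷ [] → IsCyclicFlat M X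
    to X (here refl)         = ⁅0⁆-isCyclicFlat 0<k
    to X (there (here refl)) = ⊤-isCyclicFlat k<m
    from : ∀ {X} → IsCyclicFlat M X → X ∈ˡ ⁅ zero ⁆ ∷ ⊤ ∷ []
    from cyclicFlat with cyclicFlat⇒⁅0⁆⊎⊤ cyclicFlat
    ... | inj₁ refl = here refl
    ... | inj₂ refl = there (here refl)

  dependentHyperplane : ∀ {Y} → suc ∣ Y ∣ ≡ k → k ≤ m → IsDependentHyperplane M (true ∷ Y)
  dependentHyperplane {Y} 1+∣Y∣≡k k≤m = (flat , hyperplane) , s≤s (m⊓n≤m ∣ Y ∣ k)
    where
    r[Y]≡∣Y∣ : ∣ Y ∣ ⊓ k ≡ ∣ Y ∣
    r[Y]≡∣Y∣ = m≤n⇒m⊓n≡m (≤-trans (n≤1+n ∣ Y ∣) (≤-reflexive 1+∣Y∣≡k))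
    flat : IsFlat M (true ∷ Y)
    flat zero    0∉X = contradiction here 0∉X
    flat (suc j) j∉X rewrite r[Y]≡∣Y∣ =
      ⊓-glb (p⊂q⇒∣p∣<∣q∣ (q⊆p∪q ⁅ j ⁆ Y , j , x∈p∪q⁺ (inj₁ (x∈⁅x⁆ j)) , j∉X ∘ there))
            (≤-reflexive 1+∣Y∣≡k)
    hyperplane : suc (∣ Y ∣ ⊓ k) ≡ rankM M
    hyperplane = begin
      suc (∣ Y ∣ ⊓ k)  ≡⟨ cong suc r[Y]≡∣Y∣ ⟩
      suc ∣ Y ∣        ≡⟨ 1+∣Y∣≡k ⟩
      k                ≡⟨ m≥n⇒m⊓n≡n k≤m ⟨
      m ⊓ k            ≡⟨ cong (_⊓ k) (∣⊤∣≡n m) ⟨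
      ∣ ⊤ {m} ∣ ⊓ k    ∎
      where open ≡-Reasoning

module _ (T : TM) (w : List Sym) where
  open TM T using (δ)

  Untouched : ℕ → Config T → Set
  Untouched s c = Config.head c ≤ s × (∀ i → s ≤ i → Config.tape c i ≡ tapeOf T w i)

  untouched-mono : ∀ {s s' c} → s ≤ s' → Untouched s c → Untouched s' c
  untouched-mono s≤s' (h≤s , untouched) =
    ≤-trans h≤s s≤s' , λ i s'≤i → untouched i (≤-trans s≤s' s'≤i)

  move≤suc : ∀ mv h → move T mv h ≤ suc h
  move≤suc left  h = ≤-trans (m∸n≤m h 1) (n≤1+n h)
  move≤suc right h = ≤-refl
  move≤suc stay  h = n≤1+n h

  step-untouched : ∀ {s c c'} → step T c ≡ just c' → Untouched s c → Untouched (suc s) c'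
  step-untouched {c = conf q h tape} _ _ with δ q (tape h)
  step-untouched () _ | nothing
  step-untouched {s} {conf q h tape} refl (h≤s , untouched) | just (q' , x , mv) =
    ≤-trans (move≤suc mv h) (s≤s h≤s) ,
    λ i s<i → trans (cong (λ b → if b then x else tape i) (>⇒≡ᵇ-false (≤-trans (s≤s h≤s) s<i)))
                    (untouched i (≤-trans (n≤1+n s) s<i))

  run-untouched : ∀ t {s c} → Untouched s c → Untouched (s + t) (run T t c)
  run-untouched zero    {s} u rewrite +-identityʳ s = u
  run-untouched (suc t) {s} {c} u with step T c in eq
  ... | nothing = untouched-mono {c = c} (m≤m+n s (suc t)) u
  ... | just c' rewrite +-suc s t = run-untouched t (step-untouched eq u)

  tapeOf-beyond : ∀ (u : List Sym) {i} → length u ≤ i → tapeOf T u i ≡ blank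
  tapeOf-beyond []      _         = refl
  tapeOf-beyond (_ ∷ u) (s≤s u≤i) = tapeOf-beyond u u≤i

  tapeOf-within : ∀ (u : List Sym) {i} → i < length u → tapeOf T u i ≢ blank
  tapeOf-within (_ ∷ u) {zero}  _         ()
  tapeOf-within (_ ∷ u) {suc i} (s<s i<u) = tapeOf-within u i<u

  -- After t steps the head has not passed cell t, so cell t + |w| is still blank.
  output-length : ∀ {t v} → HaltsWithin T w t v → length v ≤ t + length w
  output-length {t} {v} (_ , output) = ≮⇒≥ λ i<∣v∣ → tapeOf-within v i<∣v∣ (begin
    tapeOf T v i                           ≡⟨ output i (<⇒≤ i<∣v∣) ⟨
    Config.tape (run T t (initial T w)) i  ≡⟨ proj₂ untouched i (m≤m+n t (length w)) ⟩
    tapeOf T w i                           ≡⟨ tapeOf-beyond w (m≤n+m (length w) t) ⟩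
    blank                                  ∎)
    where
    open ≡-Reasoning
    i = t + length w
    untouched : Untouched t (run T t (initial T w))
    untouched = run-untouched t (z≤n , λ _ _ → refl)

length-binLSB : ∀ fuel x → length (binLSB fuel x) ≤ fuel
length-binLSB zero       x       = z≤n
length-binLSB (suc fuel) zero    = z≤n
length-binLSB (suc fuel) (suc x) = s≤s (length-binLSB fuel _)

length-binary : ∀ x → length (binary x) ≤ suc x
length-binary zero    = ≤-refl
length-binary (suc x) = begin
  length (map bit (reverse (binLSB (suc x) (suc x))))  ≡⟨ length-map bit (reverse (binLSB (suc x) (suc x))) ⟩
  length (reverse (binLSB (suc x) (suc x)))            ≡⟨ length-reverse (binLSB (suc x) (suc x)) ⟩
  length (binLSB (suc x) (suc x))                      ≤⟨ length-binLSB (suc x) (suc x) ⟩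
  suc x                                                ≤⟨ n≤1+n (suc x) ⟩
  suc (suc x)                                          ∎
  where open ≤-Reasoning

length-charVec : ∀ {n} (X : Subset n) → length (charVec X) ≡ n
length-charVec X = trans (length-map bit (toList X)) (length-toList X)

length-concatMap≤ : ∀ {A B : Set} (f : A → List B) {b} (xs : List A) →
                    (∀ x → length (f x) ≤ b) → length (concatMap f xs) ≤ length xs * b
length-concatMap≤ f         []       _   = z≤n
length-concatMap≤ f {b} (x ∷ xs) f≤b = begin
  length (f x ++ concatMap f xs)          ≡⟨ length-++ (f x) ⟩
  length (f x) + length (concatMap f xs)  ≤⟨ +-mono-≤ (f≤b x) (length-concatMap≤ f xs f≤b) ⟩
  b + length xs * b                       ∎
  where open ≤-Reasoning

length-cyclicFlatsDesc : ∀ {n} (M : Matroid n) L → length (cyclicFlatsDesc M L) ≤ length L * (2 * n + 3)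
length-cyclicFlatsDesc {n} M L = length-concatMap≤ entry L length-entry
  where
  open Matroid M using (r; r-bound)
  entry : Subset n → List Sym
  entry X = charVec X ++ (sep ∷ binary (r X) ++ (end ∷ []))
  length-entry : ∀ X → length (entry X) ≤ 2 * n + 3
  length-entry X = begin
    length (entry X)                       ≡⟨ length-++ (charVec X) ⟩
    length (charVec X) + suc (length (binary (r X) ++ end ∷ []))
                                           ≡⟨ cong₂ _+_ (length-charVec X) (cong suc (length-++ (binary (r X)))) ⟩
    n + suc (length (binary (r X)) + 1)    ≤⟨ +-monoʳ-≤ n (s≤s (+-monoˡ-≤ 1 (≤-trans (length-binary (r X)) (s≤s r≤n)))) ⟩
    n + suc (suc n + 1)                    ≡⟨ arithmetic n ⟩
    2 * n + 3                              ∎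
    where
    open ≤-Reasoning
    r≤n : r X ≤ n
    r≤n = ≤-trans (r-bound X) (∣p∣≤n X)
    arithmetic : ∀ n → n + suc (suc n + 1) ≡ 2 * n + 3
    arithmetic = solve 1 (λ n → n :+ (con 1 :+ (con 1 :+ n :+ con 1)) := con 2 :* n :+ con 3) refl
      where open +-*-Solver

length≤length-depHyperplanesDesc : ∀ {n} (M : Matroid n) L → length L ≤ length (depHyperplanesDesc M L)
length≤length-depHyperplanesDesc M L =
  ≤-trans (length≤entries L) (length-++-≤ʳ (concatMap (λ H → end ∷ charVec H) L) {binary (rankM M)})
  where
  length≤entries : ∀ L → length L ≤ length (concatMap (λ H → end ∷ charVec H) L)
  length≤entries []      = z≤n
  length≤entries (H ∷ L) = s≤s (≤-trans (length≤entries L) (length-++-≤ʳ _ {charVec H}))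

module HardInstance (K : ℕ) where
  open UniformWithLoop (suc K) (suc K * 2) public

  k<m : suc K < suc K * 2
  k<m = s<s (s≤s (m≤m*n K 2))

  cyclicFlatList : List (Subset (suc (suc K * 2)))
  cyclicFlatList = ⁅ zero ⁆ ∷ ⊤ ∷ []

  input : List Sym
  input = cyclicFlatsDesc M cyclicFlatList

  length-input : length input ≤ 18 * suc K
  length-input = begin
    length input                        ≤⟨ length-cyclicFlatsDesc M cyclicFlatList ⟩
    2 * (2 * (3 + K * 2) + 3)           ≤⟨ m≤m+n _ (10 * K) ⟩
    2 * (2 * (3 + K * 2) + 3) + 10 * K  ≡⟨ arithmetic K ⟩
    18 * suc K                          ∎
    where
    open ≤-Reasoning
    arithmetic : ∀ K → 2 * (2 * (3 + K * 2) + 3) + 10 * K ≡ 18 * suc K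
    arithmetic = solve 1 (λ K → con 2 :* (con 2 :* (con 3 :+ K :* con 2) :+ con 3) :+ con 10 :* K
                              := con 18 :* (con 1 :+ K)) refl
      where open +-*-Solver

  2^K≤#dependentHyperplanes : ∀ {L} → Enumerates (IsDependentHyperplane M) L → 2 ^ K ≤ length L
  2^K≤#dependentHyperplanes {L} (_ , L≡dependentHyperplanes) =
    injection⇒≤length hyperplane hyperplane-injective hyperplane∈L
    where
    -- The two unused elements make m = 2K + 2 larger than k = K + 1, so that E is cyclic.
    hyperplane : Fin (2 ^ K) → Subset (suc (suc K * 2))
    hyperplane i = true ∷ false ∷ false ∷ blocks (finToFun {2} {K} i)
    hyperplane-injective : Injective _≡_ _≡_ hyperplane
    hyperplane-injective eq =
      finToFun-injective {2} {K} (blocks-injective _ _ (cong (λ { (_ ∷ _ ∷ _ ∷ Y) → Y }) eq))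
    hyperplane∈L : ∀ i → hyperplane i ∈ˡ L
    hyperplane∈L i = Equivalence.from (L≡dependentHyperplanes (hyperplane i))
      (dependentHyperplane (cong suc (∣blocks∣ (finToFun {2} {K} i))) (<⇒≤ k<m))

  exponential≤polynomial : ∀ T c d → CFtoDHInPolyTime T c d →
                           2 ^ K ≤ c * (18 * suc K) ^ d + c + 18 * suc K
  exponential≤polynomial T c d T-converts =
    let t , t≤poly , L , L≡dependentHyperplanes , halts =
          T-converts _ M cyclicFlatList (cyclicFlats z<s k<m)
    in begin
       2 ^ K                                  ≤⟨ 2^K≤#dependentHyperplanes L≡dependentHyperplanes ⟩
       length L                               ≤⟨ length≤length-depHyperplanesDesc M L ⟩
       length (depHyperplanesDesc M L)        ≤⟨ output-length T input {t} {depHyperplanesDesc M L} halts ⟩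
       t + length input                       ≤⟨ +-mono-≤ t≤poly length-input ⟩
       c * length input ^ d + c + 18 * suc K  ≤⟨ +-monoˡ-≤ _ (+-monoˡ-≤ c (*-monoʳ-≤ c (^-monoˡ-≤ d length-input))) ⟩
       c * (18 * suc K) ^ d + c + 18 * suc K  ∎
    where open ≤-Reasoning

lemma19 : ¬ CyclicFlats≤DependentHyperplanes
lemma19 (T , c , d , T-converts) =
  let K , polynomial<2^K = polynomial∘linear<exponential c d 18 in
  <⇒≱ polynomial<2^K (HardInstance.exponential≤polynomial K T c d T-converts)
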